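{- If $\mathbf{HA}$ is closed under Markov's rule $\mathsf{MR}$, then $\mathbf{EA}$ is closed under epistemic Markov's rule $\mathsf{EMR}$.
   Context: $\mathbf{HA}$ is Heyting arithmetic; $\mathbf{EA}$ is Shapiro's epistemic arithmetic, i.e. Peano arithmetic (induction for all formulas of the modal language) over classical first-order logic with equality plus the S4 modal operator $\Box$. The languages of $\mathbf{HA}$ and $\mathbf{EA}$ are assumed to contain a common function symbol (with its defining equations) for every primitive recursive function. $\neg A$ is $A\supset\bot$ and $\Diamond A$ is $\neg\Box\neg A$. Let $R(x,y)$ range over formulas $f(x,y)=0$ with $f$ a binary primitive recursive function symbol. $\mathsf{MR}$ (for $\mathbf{HA}$): if $\vdash_{\mathbf{HA}}\forall x\neg\neg\exists yR(x,y)$ then $\vdash_{\mathbf{HA}}\forall x\exists yR(x,y)$. $\mathsf{EMR}$ (for $\mathbf{EA}$): if $\vdash_{\mathbf{EA}}\Box\forall x\Diamond\exists yR(x,y)$ then $\vdash_{\mathbf{EA}}\Box\forall x\exists yR(x,y)$. -}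

module Defs where

-- Deep embedding of Heyting arithmetic HA and Shapiro's epistemic
-- arithmetic EA (classical PA + S4 box, induction for all modal formulas),
-- both in a language with a function symbol for every primitive
-- recursive function (given by a primitive recursive derivation code)
-- together with its defining equations.

open import Data.Nat using (ℕ; zero; suc)
open import Data.Fin using (Fin)
open import Data.Bool using (Bool; true; false; T)
open import Data.Vec using (Vec; []; _∷_; lookup)
import Data.Vec as Vec
open import Data.List using (List; []; _∷_; map)
open import Data.List.Membership.Propositional using (_∈_)

data PR : ℕ → Set where
  zer  : PR 0
  succ : PR 1
  proj : ∀ {n} → Fin n → PR n
  comp : ∀ {m n} → PR m → Vec (PR n) m → PR n
  rec  : ∀ {n} → PR n → PR (suc (suc n)) → PR (suc n)
  -- rec g h (0 , ys) = g ys ; rec g h (S x , ys) = h (x , rec g h (x , ys) , ys)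

data Tm : Set where
  var : ℕ → Tm
  app : ∀ {n} → PR n → Vec Tm n → Tm

𝟎 : Tm
𝟎 = app zer []

S : Tm → Tm
S t = app succ (t ∷ [])

-- Formulas; the index says whether □ may occur
-- (false: language of HA, true: language of EA)

infixr 6 _∧'_
infixr 5 _∨'_
infixr 4 _⊃_
infix 8 _≐_

data Fm : Bool → Set where
  ⊥'   : ∀ {b} → Fm b
  _≐_  : ∀ {b} → Tm → Tm → Fm b
  _∧'_ : ∀ {b} → Fm b → Fm b → Fm b
  _∨'_ : ∀ {b} → Fm b → Fm b → Fm b
  _⊃_  : ∀ {b} → Fm b → Fm b → Fm b
  ∀'   : ∀ {b} → Fm b → Fm b     -- binds de Bruijn variable 0
  ∃'   : ∀ {b} → Fm b → Fm b
  □    : Fm true → Fm true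

¬' : ∀ {b} → Fm b → Fm b
¬' A = A ⊃ ⊥'

◇ : Fm true → Fm true
◇ A = ¬' (□ (¬' A))

Sub : Set
Sub = ℕ → Tm

mutual
  subT : Sub → Tm → Tm
  subT σ (var x) = σ x
  subT σ (app f ts) = app f (subTs σ ts)

  subTs : ∀ {n} → Sub → Vec Tm n → Vec Tm n
  subTs σ [] = []
  subTs σ (t ∷ ts) = subT σ t ∷ subTs σ ts

wkT : Tm → Tm
wkT = subT (λ x → var (suc x))

lift : Sub → Sub
lift σ zero = var zero
lift σ (suc x) = wkT (σ x)

subF : ∀ {b} → Sub → Fm b → Fm b
subF σ ⊥' = ⊥'
subF σ (t ≐ u) = subT σ t ≐ subT σ u
subF σ (A ∧' B) = subF σ A ∧' subF σ B
subF σ (A ∨' B) = subF σ A ∨' subF σ B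
subF σ (A ⊃ B) = subF σ A ⊃ subF σ B
subF σ (∀' A) = ∀' (subF (lift σ) A)
subF σ (∃' A) = ∃' (subF (lift σ) A)
subF σ (□ A) = □ (subF σ A)

wk : ∀ {b} → Fm b → Fm b
wk = subF (λ x → var (suc x))

-- A [ t ] : substitute t for variable 0 (other variables shift down)
single : Tm → Sub
single t zero = t
single t (suc x) = var x

_[_] : ∀ {b} → Fm b → Tm → Fm b
A [ t ] = subF (single t) A

-- A(x) ↦ A(S x), keeping variable 0 bound at the same place
stepSub : Sub
stepSub zero = S (var zero)
stepSub (suc x) = var (suc x)

-- Prf cl b Γ A : A is derivable from hypotheses Γ in the
-- arithmetic over language b; cl = true adds classical logic (¬¬-elim).

data Prf (cl : Bool) : (b : Bool) → List (Fm b) → Fm b → Set where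
  hyp   : ∀ {b Γ A} → A ∈ Γ → Prf cl b Γ A
  ⊥E    : ∀ {b Γ A} → Prf cl b Γ ⊥' → Prf cl b Γ A
  dne   : ∀ {b Γ A} → T cl → Prf cl b Γ (¬' (¬' A)) → Prf cl b Γ A
  ∧I    : ∀ {b Γ A B} → Prf cl b Γ A → Prf cl b Γ B → Prf cl b Γ (A ∧' B)
  ∧E₁   : ∀ {b Γ A B} → Prf cl b Γ (A ∧' B) → Prf cl b Γ A
  ∧E₂   : ∀ {b Γ A B} → Prf cl b Γ (A ∧' B) → Prf cl b Γ B
  ∨I₁   : ∀ {b Γ A B} → Prf cl b Γ A → Prf cl b Γ (A ∨' B)
  ∨I₂   : ∀ {b Γ A B} → Prf cl b Γ B → Prf cl b Γ (A ∨' B)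
  ∨E    : ∀ {b Γ A B C} → Prf cl b Γ (A ∨' B) → Prf cl b (A ∷ Γ) C →
          Prf cl b (B ∷ Γ) C → Prf cl b Γ C
  ⊃I    : ∀ {b Γ A B} → Prf cl b (A ∷ Γ) B → Prf cl b Γ (A ⊃ B)
  ⊃E    : ∀ {b Γ A B} → Prf cl b Γ (A ⊃ B) → Prf cl b Γ A → Prf cl b Γ B
  ∀I    : ∀ {b Γ A} → Prf cl b (map wk Γ) A → Prf cl b Γ (∀' A)
  ∀E    : ∀ {b Γ A} (t : Tm) → Prf cl b Γ (∀' A) → Prf cl b Γ (A [ t ])
  ∃I    : ∀ {b Γ A} (t : Tm) → Prf cl b Γ (A [ t ]) → Prf cl b Γ (∃' A)
  ∃E    : ∀ {b Γ A C} → Prf cl b Γ (∃' A) → Prf cl b (A ∷ map wk Γ) (wk C) →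
          Prf cl b Γ C
  ≐refl : ∀ {b Γ} (t : Tm) → Prf cl b Γ (t ≐ t)
  ≐subst : ∀ {b Γ} (A : Fm b) {t u : Tm} → Prf cl b Γ (t ≐ u) →
           Prf cl b Γ (A [ t ]) → Prf cl b Γ (A [ u ])
  S-inj : ∀ {b Γ} (t u : Tm) → Prf cl b Γ (S t ≐ S u ⊃ t ≐ u)
  S≠0   : ∀ {b Γ} (t : Tm) → Prf cl b Γ (¬' (S t ≐ 𝟎))
  ax-proj : ∀ {b Γ n} (i : Fin n) (ts : Vec Tm n) →
            Prf cl b Γ (app (proj i) ts ≐ lookup ts i)
  ax-comp : ∀ {b Γ m n} (f : PR m) (gs : Vec (PR n) m) (ts : Vec Tm n) →
            Prf cl b Γ (app (comp f gs) ts ≐ app f (Vec.map (λ g → app g ts) gs))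
  ax-rec0 : ∀ {b Γ n} (g : PR n) (h : PR (suc (suc n))) (ts : Vec Tm n) →
            Prf cl b Γ (app (rec g h) (𝟎 ∷ ts) ≐ app g ts)
  ax-recS : ∀ {b Γ n} (g : PR n) (h : PR (suc (suc n))) (t : Tm) (ts : Vec Tm n) →
            Prf cl b Γ (app (rec g h) (S t ∷ ts) ≐
                        app h (t ∷ app (rec g h) (t ∷ ts) ∷ ts))
  ind   : ∀ {b Γ} (A : Fm b) →
          Prf cl b Γ (A [ 𝟎 ] ⊃ ∀' (A ⊃ subF stepSub A) ⊃ ∀' A)
  nec   : ∀ {Γ A} → Prf cl true [] A → Prf cl true Γ (□ A)
  axK   : ∀ {Γ} (A B : Fm true) → Prf cl true Γ (□ (A ⊃ B) ⊃ □ A ⊃ □ B)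
  axT   : ∀ {Γ} (A : Fm true) → Prf cl true Γ (□ A ⊃ A)
  ax4   : ∀ {Γ} (A : Fm true) → Prf cl true Γ (□ A ⊃ □ (□ A))

HA⊢_ : Fm false → Set
HA⊢ A = Prf false false [] A

EA⊢_ : Fm true → Set
EA⊢ A = Prf true true [] A

-- R(x,y) :≡ f(x,y) = 0 ; inside ∀x ∃y, x is variable 1 and y is variable 0

R : ∀ {b} → PR 2 → Fm b
R f = app f (var 1 ∷ var 0 ∷ []) ≐ 𝟎

MR : Set
MR = ∀ (f : PR 2) → HA⊢ ∀' (¬' (¬' (∃' (R f)))) → HA⊢ ∀' (∃' (R f))

EMR : Set
EMR = ∀ (f : PR 2) → EA⊢ □ (∀' (◇ (∃' (R f)))) → EA⊢ □ (∀' (∃' (R f)))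

{-# OPTIONS --safe #-}
module Submission where

-- The Gödel–Gentzen negative translation with □ erased interprets EA in HA:
-- erasing □ validates S4, and the translation makes every formula ¬¬-stable,
-- which takes care of classical logic.  It sends □∀x◇∃yR to
-- ∀x¬¬¬¬∃y¬¬R, which HA-implies ∀x¬¬∃yR; Markov's rule then gives
-- HA ⊢ ∀x∃yR.  Since HA is a subsystem of EA, necessitation yields
-- EA ⊢ □∀x∃yR.

open import Defs
open import Data.Nat using (ℕ; zero; suc)
open import Data.Bool using (Bool; true; false)
open import Data.Vec using (Vec; []; _∷_)
open import Data.List using (List; []; _∷_; map)
open import Data.List.Membership.Propositional using (_∈_)
open import Data.List.Membership.Propositional.Properties using (∈-map⁺; ∈-map⁻)
open import Data.List.Relation.Unary.Any using (here; there)
open import Data.Product using (_,_)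
open import Function using (_∘_)
open import Relation.Binary.PropositionalEquality
  using (_≡_; _≗_; refl; sym; trans; cong; cong₂; subst; module ≡-Reasoning)
open ≡-Reasoning

lift-cong : ∀ {σ τ} → σ ≗ τ → lift σ ≗ lift τ
lift-cong e zero = refl
lift-cong e (suc x) = cong wkT (e x)

mutual
  subT-cong : ∀ {σ τ} → σ ≗ τ → (t : Tm) → subT σ t ≡ subT τ t
  subT-cong e (var x) = e x
  subT-cong e (app f ts) = cong (app f) (subTs-cong e ts)

  subTs-cong : ∀ {σ τ n} → σ ≗ τ → (ts : Vec Tm n) → subTs σ ts ≡ subTs τ ts
  subTs-cong e [] = refl
  subTs-cong e (t ∷ ts) = cong₂ _∷_ (subT-cong e t) (subTs-cong e ts)

subF-cong : ∀ {b σ τ} → σ ≗ τ → (A : Fm b) → subF σ A ≡ subF τ A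
subF-cong e ⊥' = refl
subF-cong e (t ≐ u) = cong₂ _≐_ (subT-cong e t) (subT-cong e u)
subF-cong e (A ∧' B) = cong₂ _∧'_ (subF-cong e A) (subF-cong e B)
subF-cong e (A ∨' B) = cong₂ _∨'_ (subF-cong e A) (subF-cong e B)
subF-cong e (A ⊃ B) = cong₂ _⊃_ (subF-cong e A) (subF-cong e B)
subF-cong e (∀' A) = cong ∀' (subF-cong (lift-cong e) A)
subF-cong e (∃' A) = cong ∃' (subF-cong (lift-cong e) A)
subF-cong e (□ A) = cong □ (subF-cong e A)

ren : (ℕ → ℕ) → Sub
ren r = var ∘ r

liftᵣ : (ℕ → ℕ) → ℕ → ℕ
liftᵣ r zero = zero
liftᵣ r (suc x) = suc (r x)

lift-ren : ∀ r → lift (ren r) ≗ ren (liftᵣ r)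
lift-ren r zero = refl
lift-ren r (suc x) = refl

lift-∘-liftᵣ : ∀ σ r → lift σ ∘ liftᵣ r ≗ lift (σ ∘ r)
lift-∘-liftᵣ σ r zero = refl
lift-∘-liftᵣ σ r (suc x) = refl

mutual
  subT-ren : ∀ σ r (t : Tm) → subT σ (subT (ren r) t) ≡ subT (σ ∘ r) t
  subT-ren σ r (var x) = refl
  subT-ren σ r (app f ts) = cong (app f) (subTs-ren σ r ts)

  subTs-ren : ∀ {n} σ r (ts : Vec Tm n) → subTs σ (subTs (ren r) ts) ≡ subTs (σ ∘ r) ts
  subTs-ren σ r [] = refl
  subTs-ren σ r (t ∷ ts) = cong₂ _∷_ (subT-ren σ r t) (subTs-ren σ r ts)

mutual
  subF-ren : ∀ {b} σ r (A : Fm b) → subF σ (subF (ren r) A) ≡ subF (σ ∘ r) A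
  subF-ren σ r ⊥' = refl
  subF-ren σ r (t ≐ u) = cong₂ _≐_ (subT-ren σ r t) (subT-ren σ r u)
  subF-ren σ r (A ∧' B) = cong₂ _∧'_ (subF-ren σ r A) (subF-ren σ r B)
  subF-ren σ r (A ∨' B) = cong₂ _∨'_ (subF-ren σ r A) (subF-ren σ r B)
  subF-ren σ r (A ⊃ B) = cong₂ _⊃_ (subF-ren σ r A) (subF-ren σ r B)
  subF-ren σ r (∀' A) = cong ∀' (subF-lift-ren σ r A)
  subF-ren σ r (∃' A) = cong ∃' (subF-lift-ren σ r A)
  subF-ren σ r (□ A) = cong □ (subF-ren σ r A)

  subF-lift-ren : ∀ {b} σ r (A : Fm b) →
                  subF (lift σ) (subF (lift (ren r)) A) ≡ subF (lift (σ ∘ r)) A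
  subF-lift-ren σ r A = begin
    subF (lift σ) (subF (lift (ren r)) A)   ≡⟨ cong (subF (lift σ)) (subF-cong (lift-ren r) A) ⟩
    subF (lift σ) (subF (ren (liftᵣ r)) A)  ≡⟨ subF-ren (lift σ) (liftᵣ r) A ⟩
    subF (lift σ ∘ liftᵣ r) A               ≡⟨ subF-cong (lift-∘-liftᵣ σ r) A ⟩
    subF (lift (σ ∘ r)) A                   ∎

lift-var : lift var ≗ var
lift-var zero = refl
lift-var (suc x) = refl

mutual
  subT-id : (t : Tm) → subT var t ≡ t
  subT-id (var x) = refl
  subT-id (app f ts) = cong (app f) (subTs-id ts)

  subTs-id : ∀ {n} (ts : Vec Tm n) → subTs var ts ≡ ts
  subTs-id [] = refl
  subTs-id (t ∷ ts) = cong₂ _∷_ (subT-id t) (subTs-id ts)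

subF-id : ∀ {b} (A : Fm b) → subF var A ≡ A
subF-id ⊥' = refl
subF-id (t ≐ u) = cong₂ _≐_ (subT-id t) (subT-id u)
subF-id (A ∧' B) = cong₂ _∧'_ (subF-id A) (subF-id B)
subF-id (A ∨' B) = cong₂ _∨'_ (subF-id A) (subF-id B)
subF-id (A ⊃ B) = cong₂ _⊃_ (subF-id A) (subF-id B)
subF-id (∀' A) = cong ∀' (trans (subF-cong lift-var A) (subF-id A))
subF-id (∃' A) = cong ∃' (trans (subF-cong lift-var A) (subF-id A))
subF-id (□ A) = cong □ (subF-id A)

single-var0-∘-liftᵣ-suc : single (var zero) ∘ liftᵣ suc ≗ var
single-var0-∘-liftᵣ-suc zero = refl
single-var0-∘-liftᵣ-suc (suc x) = refl

subF-lift-wk-[var0] : ∀ {b} (A : Fm b) → subF (lift (ren suc)) A [ var zero ] ≡ A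
subF-lift-wk-[var0] A = begin
  subF (single (var zero)) (subF (lift (ren suc)) A)   ≡⟨ cong (subF (single (var zero))) (subF-cong (lift-ren suc) A) ⟩
  subF (single (var zero)) (subF (ren (liftᵣ suc)) A)  ≡⟨ subF-ren (single (var zero)) (liftᵣ suc) A ⟩
  subF (single (var zero) ∘ liftᵣ suc) A               ≡⟨ subF-cong single-var0-∘-liftᵣ-suc A ⟩
  subF var A                                           ≡⟨ subF-id A ⟩
  A                                                    ∎

_↝⟨_⟩_ : ∀ {b₁ b₂} → List (Fm b₁) → (Fm b₁ → Fm b₂) → List (Fm b₂) → Set
Γ ↝⟨ F ⟩ Δ = ∀ {B} → B ∈ Γ → F B ∈ Δ

module _ {b₁ b₂ : Bool} {F : Fm b₁ → Fm b₂} {Γ : List (Fm b₁)} {Δ : List (Fm b₂)} where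

  ↝-keep : ∀ {A} → Γ ↝⟨ F ⟩ Δ → (A ∷ Γ) ↝⟨ F ⟩ (F A ∷ Δ)
  ↝-keep ρ (here refl) = here refl
  ↝-keep ρ (there B∈Γ) = there (ρ B∈Γ)

  ↝-drop : ∀ {X} → Γ ↝⟨ F ⟩ Δ → Γ ↝⟨ F ⟩ (X ∷ Δ)
  ↝-drop ρ B∈Γ = there (ρ B∈Γ)

  ↝-wk : (∀ A → F (wk A) ≡ wk (F A)) → Γ ↝⟨ F ⟩ Δ → map wk Γ ↝⟨ F ⟩ map wk Δ
  ↝-wk F-wk ρ B∈wkΓ with ∈-map⁻ wk B∈wkΓ
  ... | C , C∈Γ , refl = subst (_∈ map wk Δ) (sym (F-wk C)) (∈-map⁺ wk (ρ C∈Γ))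

infix 3 _⊢ᴴ_ _⊢ᴱ_

_⊢ᴴ_ : List (Fm false) → Fm false → Set
Δ ⊢ᴴ A = Prf false false Δ A

_⊢ᴱ_ : List (Fm true) → Fm true → Set
Γ ⊢ᴱ A = Prf true true Γ A

cast : ∀ {cl b Γ A B} → A ≡ B → Prf cl b Γ A → Prf cl b Γ B
cast {cl} {b} {Γ} = subst (Prf cl b Γ)

infixl 5 _·_

_·_ : ∀ {cl b Γ A B} → Prf cl b Γ (A ⊃ B) → Prf cl b Γ A → Prf cl b Γ B
_·_ = ⊃E

module _ {cl b : Bool} where

  #0 : ∀ {Γ A} → Prf cl b (A ∷ Γ) A
  #0 = hyp (here refl)

  #1 : ∀ {Γ A A₀} → Prf cl b (A₀ ∷ A ∷ Γ) A
  #1 = hyp (there (here refl))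

  #2 : ∀ {Γ A A₀ A₁} → Prf cl b (A₀ ∷ A₁ ∷ A ∷ Γ) A
  #2 = hyp (there (there (here refl)))

  #4 : ∀ {Γ A A₀ A₁ A₂ A₃} → Prf cl b (A₀ ∷ A₁ ∷ A₂ ∷ A₃ ∷ A ∷ Γ) A
  #4 = hyp (there (there (there (there (here refl)))))

-- Gödel–Gentzen translation; □ is erased, which validates necessitation and K, T, 4.
N : Fm true → Fm false
N ⊥' = ⊥'
N (t ≐ u) = ¬' (¬' (t ≐ u))
N (A ∧' B) = N A ∧' N B
N (A ∨' B) = ¬' (¬' (N A ∨' N B))
N (A ⊃ B) = N A ⊃ N B
N (∀' A) = ∀' (N A)
N (∃' A) = ¬' (¬' (∃' (N A)))
N (□ A) = N A

N-subF : ∀ σ (A : Fm true) → N (subF σ A) ≡ subF σ (N A)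
N-subF σ ⊥' = refl
N-subF σ (t ≐ u) = refl
N-subF σ (A ∧' B) = cong₂ _∧'_ (N-subF σ A) (N-subF σ B)
N-subF σ (A ∨' B) = cong (¬' ∘ ¬') (cong₂ _∨'_ (N-subF σ A) (N-subF σ B))
N-subF σ (A ⊃ B) = cong₂ _⊃_ (N-subF σ A) (N-subF σ B)
N-subF σ (∀' A) = cong ∀' (N-subF (lift σ) A)
N-subF σ (∃' A) = cong (¬' ∘ ¬' ∘ ∃') (N-subF (lift σ) A)
N-subF σ (□ A) = N-subF σ A

¬-stable : ∀ {Δ} X → Δ ⊢ᴴ ¬' (¬' (¬' X)) ⊃ ¬' X
¬-stable X = ⊃I (⊃I (#1 · ⊃I (#0 · #1)))

N-stable : ∀ {Δ} (A : Fm true) → Δ ⊢ᴴ ¬' (¬' (N A)) ⊃ N A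
N-stable ⊥' = ⊃I (#0 · ⊃I #0)
N-stable (t ≐ u) = ¬-stable _
N-stable (A ∧' B) = ⊃I (∧I
  (N-stable A · ⊃I (#1 · ⊃I (#1 · ∧E₁ #0)))
  (N-stable B · ⊃I (#1 · ⊃I (#1 · ∧E₂ #0))))
N-stable (A ∨' B) = ¬-stable _
N-stable (A ⊃ B) = ⊃I (⊃I (N-stable B · ⊃I (#2 · ⊃I (#1 · (#0 · #2)))))
N-stable (∀' A) = ⊃I (∀I (N-stable A · ⊃I (#1 · ⊃I (#1 · instantiate-var0 #0))))
  where
  instantiate-var0 : ∀ {Δ} → Δ ⊢ᴴ ∀' (subF (lift (ren suc)) (N A)) → Δ ⊢ᴴ N A
  instantiate-var0 p = cast (subF-lift-wk-[var0] (N A)) (∀E (var zero) p)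
N-stable (∃' A) = ¬-stable _
N-stable (□ A) = N-stable A

N-derivation : ∀ {Γ A Δ} → Γ ⊢ᴱ A → Γ ↝⟨ N ⟩ Δ → Δ ⊢ᴴ N A
N-derivation (hyp A∈Γ) ρ = hyp (ρ A∈Γ)
N-derivation (⊥E p) ρ = ⊥E (N-derivation p ρ)
N-derivation {A = A} (dne _ p) ρ = N-stable A · N-derivation p ρ
N-derivation (∧I p q) ρ = ∧I (N-derivation p ρ) (N-derivation q ρ)
N-derivation (∧E₁ p) ρ = ∧E₁ (N-derivation p ρ)
N-derivation (∧E₂ p) ρ = ∧E₂ (N-derivation p ρ)
N-derivation (∨I₁ p) ρ = ⊃I (#0 · ∨I₁ (N-derivation p (↝-drop ρ)))
N-derivation (∨I₂ p) ρ = ⊃I (#0 · ∨I₂ (N-derivation p (↝-drop ρ)))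
N-derivation {A = C} (∨E p q r) ρ =
  N-stable C · ⊃I (N-derivation p (↝-drop ρ) · ⊃I (∨E #0
    (#2 · N-derivation q (↝-keep (↝-drop (↝-drop ρ))))
    (#2 · N-derivation r (↝-keep (↝-drop (↝-drop ρ))))))
N-derivation (⊃I p) ρ = ⊃I (N-derivation p (↝-keep ρ))
N-derivation (⊃E p q) ρ = N-derivation p ρ · N-derivation q ρ
N-derivation (∀I p) ρ = ∀I (N-derivation p (↝-wk (N-subF _) ρ))
N-derivation (∀E {A = A} t p) ρ = cast (sym (N-subF (single t) A)) (∀E t (N-derivation p ρ))
N-derivation (∃I {A = A} t p) ρ =
  ⊃I (#0 · ∃I t (cast (N-subF (single t) A) (N-derivation p (↝-drop ρ))))
N-derivation (∃E {C = C} p q) ρ =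
  N-stable C · ⊃I (N-derivation p (↝-drop ρ) · ⊃I (∃E #0
    (#2 · cast (N-subF _ C) (N-derivation q (↝-keep (↝-drop (↝-drop (↝-wk (N-subF _) ρ))))))))
N-derivation (≐refl t) ρ = ⊃I (#0 · ≐refl t)
N-derivation (≐subst A {t} {u} p q) ρ =
  N-stable (A [ u ]) · ⊃I (N-derivation p (↝-drop ρ) · ⊃I (#1 · cast (sym (N-subF (single u) A))
    (≐subst (N A) #0 (cast (N-subF (single t) A) (N-derivation q (↝-drop (↝-drop ρ)))))))
N-derivation (S-inj t u) ρ = ⊃I (⊃I (#1 · ⊃I (#1 · (S-inj t u · #0))))
N-derivation (S≠0 t) ρ = ⊃I (#0 · S≠0 t)
N-derivation (ax-proj i ts) ρ = ⊃I (#0 · ax-proj i ts)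
N-derivation (ax-comp f gs ts) ρ = ⊃I (#0 · ax-comp f gs ts)
N-derivation (ax-rec0 g h ts) ρ = ⊃I (#0 · ax-rec0 g h ts)
N-derivation (ax-recS g h t ts) ρ = ⊃I (#0 · ax-recS g h t ts)
N-derivation (ind A) ρ = cast
  (cong₂ _⊃_ (sym (N-subF (single 𝟎) A))
    (cong (λ B → ∀' (N A ⊃ B) ⊃ ∀' (N A)) (sym (N-subF stepSub A))))
  (ind (N A))
N-derivation (nec p) ρ = N-derivation p (λ ())
N-derivation (axK A B) ρ = ⊃I (⊃I (#1 · #0))
N-derivation (axT A) ρ = ⊃I #0
N-derivation (ax4 A) ρ = ⊃I #0

N-theorem : ∀ {A} → EA⊢ A → HA⊢ N A
N-theorem p = N-derivation p (λ ())

embed : Fm false → Fm true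
embed ⊥' = ⊥'
embed (t ≐ u) = t ≐ u
embed (A ∧' B) = embed A ∧' embed B
embed (A ∨' B) = embed A ∨' embed B
embed (A ⊃ B) = embed A ⊃ embed B
embed (∀' A) = ∀' (embed A)
embed (∃' A) = ∃' (embed A)

embed-subF : ∀ σ (A : Fm false) → embed (subF σ A) ≡ subF σ (embed A)
embed-subF σ ⊥' = refl
embed-subF σ (t ≐ u) = refl
embed-subF σ (A ∧' B) = cong₂ _∧'_ (embed-subF σ A) (embed-subF σ B)
embed-subF σ (A ∨' B) = cong₂ _∨'_ (embed-subF σ A) (embed-subF σ B)
embed-subF σ (A ⊃ B) = cong₂ _⊃_ (embed-subF σ A) (embed-subF σ B)
embed-subF σ (∀' A) = cong ∀' (embed-subF (lift σ) A)
embed-subF σ (∃' A) = cong ∃' (embed-subF (lift σ) A)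

embed-derivation : ∀ {Δ A Γ} → Δ ⊢ᴴ A → Δ ↝⟨ embed ⟩ Γ → Γ ⊢ᴱ embed A
embed-derivation (hyp A∈Δ) ρ = hyp (ρ A∈Δ)
embed-derivation (⊥E p) ρ = ⊥E (embed-derivation p ρ)
embed-derivation (dne () p) ρ
embed-derivation (∧I p q) ρ = ∧I (embed-derivation p ρ) (embed-derivation q ρ)
embed-derivation (∧E₁ p) ρ = ∧E₁ (embed-derivation p ρ)
embed-derivation (∧E₂ p) ρ = ∧E₂ (embed-derivation p ρ)
embed-derivation (∨I₁ p) ρ = ∨I₁ (embed-derivation p ρ)
embed-derivation (∨I₂ p) ρ = ∨I₂ (embed-derivation p ρ)
embed-derivation (∨E p q r) ρ =
  ∨E (embed-derivation p ρ) (embed-derivation q (↝-keep ρ)) (embed-derivation r (↝-keep ρ))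
embed-derivation (⊃I p) ρ = ⊃I (embed-derivation p (↝-keep ρ))
embed-derivation (⊃E p q) ρ = embed-derivation p ρ · embed-derivation q ρ
embed-derivation (∀I p) ρ = ∀I (embed-derivation p (↝-wk (embed-subF _) ρ))
embed-derivation (∀E {A = A} t p) ρ =
  cast (sym (embed-subF (single t) A)) (∀E t (embed-derivation p ρ))
embed-derivation (∃I {A = A} t p) ρ =
  ∃I t (cast (embed-subF (single t) A) (embed-derivation p ρ))
embed-derivation (∃E {C = C} p q) ρ =
  ∃E (embed-derivation p ρ)
     (cast (embed-subF _ C) (embed-derivation q (↝-keep (↝-wk (embed-subF _) ρ))))
embed-derivation (≐refl t) ρ = ≐refl t
embed-derivation (≐subst A {t} {u} p q) ρ = cast (sym (embed-subF (single u) A))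
  (≐subst (embed A) (embed-derivation p ρ)
    (cast (embed-subF (single t) A) (embed-derivation q ρ)))
embed-derivation (S-inj t u) ρ = S-inj t u
embed-derivation (S≠0 t) ρ = S≠0 t
embed-derivation (ax-proj i ts) ρ = ax-proj i ts
embed-derivation (ax-comp f gs ts) ρ = ax-comp f gs ts
embed-derivation (ax-rec0 g h ts) ρ = ax-rec0 g h ts
embed-derivation (ax-recS g h t ts) ρ = ax-recS g h t ts
embed-derivation (ind A) ρ = cast
  (cong₂ _⊃_ (sym (embed-subF (single 𝟎) A))
    (cong (λ B → ∀' (embed A ⊃ B) ⊃ ∀' (embed A)) (sym (embed-subF stepSub A))))
  (ind (embed A))

embed-theorem : ∀ {A} → HA⊢ A → EA⊢ embed A
embed-theorem p = embed-derivation p (λ ())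

¬¬¬¬∃¬¬⇒¬¬∃ : ∀ {Δ} (A : Fm false) → Δ ⊢ᴴ ¬' (¬' (¬' (¬' (∃' (¬' (¬' A)))))) ⊃ ¬' (¬' (∃' A))
¬¬¬¬∃¬¬⇒¬¬∃ A = ⊃I (⊃I (#1 · ⊃I (#0 · ⊃I (∃E #0 (#0 · ⊃I (#4 · ∃I (var zero) witness))))))
  where
  witness : ∀ {Δ} → A ∷ Δ ⊢ᴴ subF (lift (ren suc)) A [ var zero ]
  witness = cast (sym (subF-lift-wk-[var0] A)) #0

theorem4p1 : MR → EMR
theorem4p1 mr f ⊢□∀◇∃R = nec (embed-theorem (mr f ⊢∀¬¬∃R))
  where
  ⊢∀¬¬∃R : HA⊢ ∀' (¬' (¬' (∃' (R f))))
  ⊢∀¬¬∃R = ∀I (¬¬¬¬∃¬¬⇒¬¬∃ (R f) · ∀E (var zero) (N-theorem ⊢□∀◇∃R))
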